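{- Let $r$ be a relation over a schema context on $U$, let $g$ be a reality and let $x,y\in L_U$. Then $r\models_g g(x)\to g(y)$ if and only if for every $z\in L_r$, $g(x)\subseteq g(z)$ implies $g(y)\subseteq g(z)$.
   Context: A relation scheme is a finite set $U=\{A_1,\dots,A_n\}$ of attributes with domains $\mathrm{dom}(A)$. A schema context assigns to each $A$ a finite lattice $L_A$ (bottom $0_A$, top $1_A$) and a surjective comparability function $f_A:\mathrm{dom}(A)^2\to L_A$ with $f_A(u,u)=1_A$, $f_A(u,v)=f_A(v,u)$. $L_U=\prod_A L_A$ (componentwise order). A relation $r$ is a finite set of tuples $t$ with $t[A]\in\mathrm{dom}(A)$; $f_U(t_1,t_2)=\langle f_{A_i}(t_1[A_i],t_2[A_i])\rangle_{i}$, $f_U(r)=\{f_U(t_1,t_2):t_1,t_2\in r\}$, $L_r=\{\bigwedge T: T\subseteq f_U(r)\}$ (empty meet = top). An attribute interpretation is an increasing $h_A:L_A\to\{0,1\}$ with $h_A(0_A)=0,h_A(1_A)=1$; a schema interpretation is $g(x)=\langle h_{A_1}(x[A_1]),\dots,h_{A_n}(x[A_n])\rangle$, identified with the subset of $U$ where it equals $1$. A reality is a schema interpretation that is a $\wedge$-homomorphism into $\{0,1\}^n$. By definition $r\models_g g(x)\to g(y)$ means: for all $t_1,t_2\in r$, $g(x)\subseteq g(f_U(t_1,t_2))$ implies $g(y)\subseteq g(f_U(t_1,t_2))$. -}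

module Defs where

open import Data.Nat using (ℕ)
open import Data.Fin using (Fin)
open import Data.Bool using (Bool; true; false; _∧_) renaming (_≤_ to _≤ᵇ_)
open import Data.List using (List; []; _∷_; foldr; map)
open import Data.List.Relation.Unary.Any using (Any)
open import Data.List.Relation.Unary.All using (All)
open import Data.List.Membership.Propositional using (_∈_)
open import Data.Product using (Σ; ∃; _×_; _,_; proj₁; proj₂)
open import Relation.Binary.PropositionalEquality using (_≡_)
open import Relation.Binary.Lattice.Bundles using (BoundedLattice)

-- A schema context on U = Fin n (attributes A₁ … Aₙ).
record SchemaContext (n : ℕ) : Set₁ where
  field
    dom    : Fin n → Set
    L      : Fin n → BoundedLattice _ _ _
    finite : ∀ A → Σ (List (BoundedLattice.Carrier (L A)))
                     (λ xs → ∀ x → Any (λ y → BoundedLattice._≈_ (L A) x y) xs)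
    f      : ∀ A → dom A → dom A → BoundedLattice.Carrier (L A)
    f-surj : ∀ A (l : BoundedLattice.Carrier (L A)) →
               Σ (dom A) (λ u → Σ (dom A) (λ v → BoundedLattice._≈_ (L A) (f A u v) l))
    f-refl : ∀ A (u : dom A) → BoundedLattice._≈_ (L A) (f A u u) (BoundedLattice.⊤ (L A))
    f-sym  : ∀ A (u v : dom A) → BoundedLattice._≈_ (L A) (f A u v) (f A v u)

module _ {n : ℕ} (S : SchemaContext n) where
  open SchemaContext S

  Lₐ : Fin n → Set
  Lₐ A = BoundedLattice.Carrier (L A)

  LU : Set
  LU = (A : Fin n) → Lₐ A

  _≈U_ : LU → LU → Set
  x ≈U y = ∀ A → BoundedLattice._≈_ (L A) (x A) (y A)

  _∧U_ : LU → LU → LU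
  (x ∧U y) A = BoundedLattice._∧_ (L A) (x A) (y A)

  ⊤U : LU
  ⊤U A = BoundedLattice.⊤ (L A)

  Tuple : Set
  Tuple = (A : Fin n) → dom A

  -- a (finite) relation; duplicates are irrelevant
  Relation : Set
  Relation = List Tuple

  fU : Tuple → Tuple → LU
  fU t₁ t₂ A = f A (t₁ A) (t₂ A)

  meetPairs : List (Tuple × Tuple) → LU
  meetPairs T = foldr _∧U_ ⊤U (map (λ p → fU (proj₁ p) (proj₂ p)) T)

  -- z ∈ L_r : z is the meet of some subset T of f_U(r)
  InLr : Relation → LU → Set
  InLr r z = Σ (List (Tuple × Tuple))
               (λ T → All (λ p → (proj₁ p ∈ r) × (proj₂ p ∈ r)) T × (z ≈U meetPairs T))

  record AttrInterp (A : Fin n) : Set where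
    field
      h     : Lₐ A → Bool
      mono  : ∀ {x y} → BoundedLattice._≤_ (L A) x y → h x ≤ᵇ h y
      h-bot : h (BoundedLattice.⊥ (L A)) ≡ false
      h-top : h (BoundedLattice.⊤ (L A)) ≡ true

  SchemaInterp : Set
  SchemaInterp = (A : Fin n) → AttrInterp A

  -- g(x) ∈ {0,1}^n, identified with a subset of U
  apply : SchemaInterp → LU → Fin n → Bool
  apply g x A = AttrInterp.h (g A) (x A)

  _⊆ᵇ_ : (Fin n → Bool) → (Fin n → Bool) → Set
  X ⊆ᵇ Y = ∀ A → X A ≡ true → Y A ≡ true

  IsReality : SchemaInterp → Set
  IsReality g = ∀ x y A → apply g (x ∧U y) A ≡ (apply g x A ∧ apply g y A)

  Satisfies : Relation → SchemaInterp → LU → LU → Set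
  Satisfies r g x y = ∀ t₁ t₂ → t₁ ∈ r → t₂ ∈ r →
    apply g x ⊆ᵇ apply g (fU t₁ t₂) → apply g y ⊆ᵇ apply g (fU t₁ t₂)

-- Write Good z for "g(x) ⊆ g(z) implies g(y) ⊆ g(z)".  Satisfaction of
-- g(x) → g(y) says precisely that Good holds at every f_U(t₁,t₂) with
-- t₁, t₂ ∈ r.  The proof rests on two facts:
--   * since g is a ∧-homomorphism, X ⊆ g(a ∧ b) iff X ⊆ g(a) and X ⊆ g(b);
--     hence Good holds at ⊤ and is closed under binary meets, so it holds
--     at every finite meet of values where it holds (meetPairs);
--   * g is invariant under the lattice equality, so Good transfers along ≈.
-- Then (⇒) every z ∈ L_r is ≈ to such a finite meet, and (⇐) every
-- f_U(t₁,t₂) lies in L_r as the meet of a one-element family.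
module Submission where

open import Defs
open import Data.Nat using (ℕ)
open import Data.Fin using (Fin)
open import Data.Bool using (Bool; true; _∧_)
open import Data.Bool.Properties using (≤-antisym)
open import Data.List using (List; []; _∷_)
open import Data.List.Relation.Unary.All using (All; []; _∷_)
open import Data.List.Membership.Propositional using (_∈_)
open import Data.Product using (_×_; _,_; proj₁; proj₂)
open import Function.Bundles using (_⇔_; mk⇔)
open import Relation.Binary.PropositionalEquality using (_≡_; refl; sym; trans)
open import Relation.Binary.Lattice.Bundles using (BoundedLattice)
import Relation.Binary.Lattice.Properties.BoundedMeetSemilattice as BoundedMeetProps

∧-true-split : ∀ {a b : Bool} → (a ∧ b) ≡ true → (a ≡ true) × (b ≡ true)
∧-true-split {true} {true} refl = refl , refl

∧-true-intro : ∀ {a b : Bool} → a ≡ true → b ≡ true → (a ∧ b) ≡ true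
∧-true-intro refl refl = refl

module _ {n : ℕ} (S : SchemaContext n) where
  open SchemaContext S

  ≈U-sym : ∀ {x y : LU S} → _≈U_ S x y → _≈U_ S y x
  ≈U-sym x≈y A = BoundedLattice.Eq.sym (L A) (x≈y A)

  ∧U-identityʳ : ∀ (x : LU S) → _≈U_ S x (_∧U_ S x (⊤U S))
  ∧U-identityʳ x = ≈U-sym (λ A → BoundedMeetProps.identityʳ (BoundedLattice.boundedMeetSemilattice (L A)) (x A))

  -- An increasing map into Bool respects the lattice equality, so g(x)
  -- depends only on the ≈U-class of x.
  apply-resp : (g : SchemaInterp S) {x y : LU S} → _≈U_ S x y →
               ∀ A → apply S g x A ≡ apply S g y A
  apply-resp g x≈y A = ≤-antisym (mono (reflexive (x≈y A)))
                                 (mono (reflexive (Eq.sym (x≈y A))))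
    where open AttrInterp (g A)
          open BoundedLattice (L A)

  ⊆-resp-≈ : (g : SchemaInterp S) {X : Fin n → Bool} {z z′ : LU S} →
             _≈U_ S z z′ → _⊆ᵇ_ S X (apply S g z) → _⊆ᵇ_ S X (apply S g z′)
  ⊆-resp-≈ g z≈z′ X⊆z A e = trans (sym (apply-resp g z≈z′ A)) (X⊆z A e)

  module _ (g : SchemaInterp S) (reality : IsReality S g) where

    ⊆-meet-split : ∀ {X : Fin n → Bool} a b → _⊆ᵇ_ S X (apply S g (_∧U_ S a b)) →
                   _⊆ᵇ_ S X (apply S g a) × _⊆ᵇ_ S X (apply S g b)
    ⊆-meet-split a b X⊆ab =
        (λ A e → proj₁ (∧-true-split (meet A e)))
      , (λ A e → proj₂ (∧-true-split (meet A e)))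
      where meet = λ A e → trans (sym (reality a b A)) (X⊆ab A e)

    ⊆-meet-intro : ∀ {X : Fin n → Bool} a b → _⊆ᵇ_ S X (apply S g a) →
                   _⊆ᵇ_ S X (apply S g b) → _⊆ᵇ_ S X (apply S g (_∧U_ S a b))
    ⊆-meet-intro a b X⊆a X⊆b A e =
      trans (reality a b A) (∧-true-intro (X⊆a A e) (X⊆b A e))

    module _ (x y : LU S) where

      Good : LU S → Set
      Good z = _⊆ᵇ_ S (apply S g x) (apply S g z) → _⊆ᵇ_ S (apply S g y) (apply S g z)

      good-⊤ : Good (⊤U S)
      good-⊤ _ A _ = AttrInterp.h-top (g A)

      good-∧ : ∀ a b → Good a → Good b → Good (_∧U_ S a b)
      good-∧ a b good-a good-b x⊆ab =
        let x⊆a , x⊆b = ⊆-meet-split a b x⊆ab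
        in ⊆-meet-intro a b (good-a x⊆a) (good-b x⊆b)

      good-resp-≈ : ∀ {z z′} → _≈U_ S z z′ → Good z → Good z′
      good-resp-≈ z≈z′ good-z x⊆z′ =
        ⊆-resp-≈ g z≈z′ (good-z (⊆-resp-≈ g (≈U-sym z≈z′) x⊆z′))

      good-meetPairs : ∀ (T : List (Tuple S × Tuple S)) →
                       All (λ p → Good (fU S (proj₁ p) (proj₂ p))) T →
                       Good (meetPairs S T)
      good-meetPairs []      []                = good-⊤
      good-meetPairs (p ∷ T) (good-p ∷ good-T) =
        good-∧ _ (meetPairs S T) good-p (good-meetPairs T good-T)

fU-∈-Lr : ∀ {n} (S : SchemaContext n) {r : Relation S} {t₁ t₂ : Tuple S} →
          t₁ ∈ r → t₂ ∈ r → InLr S r (fU S t₁ t₂)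
fU-∈-Lr S t₁∈r t₂∈r = _ ∷ [] , (t₁∈r , t₂∈r) ∷ [] , ∧U-identityʳ S _

proposition5 : (n : ℕ) (S : SchemaContext n) (r : Relation S) (g : SchemaInterp S) →
    IsReality S g → (x y : LU S) →
    Satisfies S r g x y ⇔
    (∀ z → InLr S r z → _⊆ᵇ_ S (apply S g x) (apply S g z) → _⊆ᵇ_ S (apply S g y) (apply S g z))
proposition5 n S r g reality x y = mk⇔ satisfied⇒good-on-Lr good-on-Lr⇒satisfied
  where
  satisfied⇒good-on-Lr : Satisfies S r g x y → ∀ z → InLr S r z → Good S g reality x y z
  satisfied⇒good-on-Lr sat z (T , T⊆r , z≈meet) =
    good-resp-≈ S g reality x y (≈U-sym S z≈meet)
      (good-meetPairs S g reality x y T (good-pairs T T⊆r))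
    where
    good-pairs : ∀ T → All (λ p → (proj₁ p ∈ r) × (proj₂ p ∈ r)) T →
                 All (λ p → Good S g reality x y (fU S (proj₁ p) (proj₂ p))) T
    good-pairs []      []                  = []
    good-pairs (p ∷ T) ((m₁ , m₂) ∷ T⊆r′) = sat _ _ m₁ m₂ ∷ good-pairs T T⊆r′

  good-on-Lr⇒satisfied : (∀ z → InLr S r z → Good S g reality x y z) → Satisfies S r g x y
  good-on-Lr⇒satisfied good t₁ t₂ t₁∈r t₂∈r = good (fU S t₁ t₂) (fU-∈-Lr S t₁∈r t₂∈r)
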